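{- Let $k\ge 2$ and $q\ge1$ be integers. (i) If for $1\le j\le q$ the sequences $(a_{j,1},\dots,a_{j,k})$ are $k$-flip sequences, then $(a_1,\dots,a_k)$ with $a_i=\sum_{j=1}^q a_{j,i}$ is a $k$-flip sequence. (ii) If for $1\le j\le q$, $H_j$ is an $(r_j,c_j)$-constant graph, then there exists a $\left(\sum_{j=1}^q r_j,\sum_{j=1}^q c_j\right)$-constant graph. (iii) If for $1\le j\le q$, $H_j$ is an $(r_j,b)$-regular graph, then there exists a $\left(\sum_{j=1}^q r_j, b\right)$-regular graph. (iv) If for $1\le j\le q$, $G_j$ is a constant-link graph with link $H_j$, then $G_1\,\square\cdots\square\,G_q$ is a constant-link graph with link the disjoint union $H_1\cup\cdots\cup H_q$.
   Context: All graphs are finite and simple. For a strictly increasing sequence of positive integers $(a_1,\dots,a_k)$, a graph $G$ is an $(a_1,\dots,a_k)$-flip graph if there is an edge-colouring $f:E(G)\to\{1,\dots,k\}$ such that every vertex is incident with exactly $a_j$ edges of colour $j$ for each $j$, and for every vertex $v$, $e_k[v]<\cdots<e_1[v]$, where $e_j[v]$ is the number of colour-$j$ edges with both endpoints in $N[v]=N(v)\cup\{v\}$; such a sequence is a $k$-flip sequence if some graph realises it. An $(r,c)$-constant graph is an $r$-regular graph in which every open neighbourhood $N(v)$ induces exactly $c$ edges. An $(r,b)$-regular graph is an $r$-regular graph in which every open neighbourhood induces a $b$-regular graph. A constant-link graph with link $H$ is a graph in which the subgraph induced by every open neighbourhood is isomorphic to $H$. $\square$ denotes the Cartesian product: $V(G\,\square\,H)=V(G)\times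 V(H)$, $(u,v)\sim(u',v')$ iff ($u=u'$ and $vv'\in E(H)$) or ($v=v'$ and $uu'\in E(G)$). -}

module Defs where

open import Data.Nat using (ℕ; zero; suc; _+_; _*_; _≤_; _<_)
open import Data.Nat.Properties using (≤-trans; m≤m+n; *-mono-≤)
open import Data.Fin as Fin using (Fin; toℕ; remQuot; splitAt)
open import Data.Bool using (Bool; true; false; _∧_; _∨_; if_then_else_; T)
open import Data.Bool.Properties using (∧-zeroʳ)
open import Data.Product using (Σ; ∃; _×_; _,_; proj₁; proj₂)
open import Data.Sum using (_⊎_; inj₁; inj₂)
open import Function.Bundles using (_↔_; Inverse)
open import Relation.Nullary.Decidable using (⌊_⌋; yes; no)
open import Relation.Binary.PropositionalEquality using (_≡_; refl; sym; cong₂)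

-- Finite simple graphs on vertex set Fin n (n may be 0: the null graph).

record Graph : Set where
  field
    n      : ℕ
    adj    : Fin n → Fin n → Bool
    adj-sym    : ∀ u v → adj u v ≡ adj v u
    adj-irrefl : ∀ v → adj v v ≡ false
open Graph public

-- "graph" in the paper's sense: nonempty vertex set
NonEmpty : Graph → Set
NonEmpty G = 1 ≤ n G

sumF : ∀ {m} → (Fin m → ℕ) → ℕ
sumF {zero}  f = 0
sumF {suc m} f = f Fin.zero + sumF (λ i → f (Fin.suc i))

count : ∀ {m} → (Fin m → Bool) → ℕ
count p = sumF (λ i → if p i then 1 else 0)

eqF : ∀ {m} → Fin m → Fin m → Bool
eqF a b = ⌊ a Fin.≟ b ⌋

countPairs : ∀ {m} → (Fin m → Fin m → Bool) → ℕ
countPairs p = sumF (λ x → count (λ y → ⌊ x Fin.<? y ⌋ ∧ p x y))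

deg : (G : Graph) → Fin (n G) → ℕ
deg G v = count (adj G v)

Regular : Graph → ℕ → Set
Regular G r = ∀ v → deg G v ≡ r

edgesIn : (G : Graph) → (Fin (n G) → Bool) → ℕ
edgesIn G S = countPairs (λ x y → S x ∧ S y ∧ adj G x y)

IsConstant : Graph → ℕ → ℕ → Set
IsConstant G r c = Regular G r × (∀ v → edgesIn G (adj G v) ≡ c)

-- (r,b)-regular graph: r-regular, and every open neighbourhood induces a
-- b-regular graph (every u ∈ N(v) has exactly b neighbours inside N(v))
IsRBRegular : Graph → ℕ → ℕ → Set
IsRBRegular G r b =
  Regular G r ×
  (∀ v u → T (adj G v u) → count (λ w → adj G v w ∧ adj G u w) ≡ b)

-- Flip graphs / flip sequences (colours 1..k are Fin k, colour 1 = zero)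

StrictlyIncreasing : ∀ {k} → (Fin k → ℕ) → Set
StrictlyIncreasing a = ∀ i j → i Fin.< j → a i < a j

Positive : ∀ {k} → (Fin k → ℕ) → Set
Positive a = ∀ i → 1 ≤ a i

-- an edge colouring given as a symmetric function on pairs of vertices
-- (its values on non-edges are irrelevant)
IsFlipColouring : (G : Graph) (k : ℕ) → (Fin k → ℕ) →
                  (Fin (n G) → Fin (n G) → Fin k) → Set
IsFlipColouring G k a f =
  (∀ u v → f u v ≡ f v u) ×
  (∀ v j → count (λ u → adj G v u ∧ eqF (f v u) j) ≡ a j) ×
  (∀ v i j → i Fin.< j → e v j < e v i)
  where
  closedN : Fin (n G) → Fin (n G) → Bool
  closedN v x = eqF x v ∨ adj G v x
  e : Fin (n G) → Fin k → ℕ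
  e v j = countPairs (λ x y → closedN v x ∧ closedN v y ∧ adj G x y ∧ eqF (f x y) j)

IsFlipGraph : (G : Graph) (k : ℕ) → (Fin k → ℕ) → Set
IsFlipGraph G k a = ∃ λ f → IsFlipColouring G k a f

IsFlipSequence : (k : ℕ) → (Fin k → ℕ) → Set
IsFlipSequence k a =
  StrictlyIncreasing a × Positive a ×
  (∃ λ G → NonEmpty G × IsFlipGraph G k a)

Nbhd : (G : Graph) → Fin (n G) → Set
Nbhd G v = Σ (Fin (n G)) (λ u → T (adj G v u))

LinkIso : (G : Graph) → Fin (n G) → Graph → Set
LinkIso G v H =
  Σ (Fin (n H) ↔ Nbhd G v) λ φ →
    ∀ x y → adj H x y ≡ adj G (proj₁ (Inverse.to φ x)) (proj₁ (Inverse.to φ y))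

IsConstantLink : Graph → Graph → Set
IsConstantLink G H = ∀ v → LinkIso G v H

private
  eqF-sym : ∀ {m} (a b : Fin m) → eqF a b ≡ eqF b a
  eqF-sym a b with a Fin.≟ b | b Fin.≟ a
  ... | yes _ | yes _ = refl
  ... | no _  | no _  = refl
  ... | yes p | no q  = Data.Empty.⊥-elim (q (sym p)) where import Data.Empty
  ... | no p  | yes q = Data.Empty.⊥-elim (p (sym q)) where import Data.Empty

  eqF-refl : ∀ {m} (a : Fin m) → eqF a a ≡ true
  eqF-refl a with a Fin.≟ a
  ... | yes _ = refl
  ... | no p  = Data.Empty.⊥-elim (p refl) where import Data.Empty

□adj : (G H : Graph) → Fin (n G) × Fin (n H) → Fin (n G) × Fin (n H) → Bool
□adj G H (a , b) (a' , b') = (eqF a a' ∧ adj H b b') ∨ (eqF b b' ∧ adj G a a')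

private
  □adj-sym : ∀ G H p p' → □adj G H p p' ≡ □adj G H p' p
  □adj-sym G H (a , b) (a' , b') =
    cong₂ _∨_ (cong₂ _∧_ (eqF-sym a a') (adj-sym H b b'))
              (cong₂ _∧_ (eqF-sym b b') (adj-sym G a a'))
  □adj-irrefl : ∀ G H p → □adj G H p p ≡ false
  □adj-irrefl G H (a , b) rewrite adj-irrefl H b | adj-irrefl G a
    | ∧-zeroʳ (eqF a a) | ∧-zeroʳ (eqF b b) = refl

-- vertex (a , b) of G □ H is encoded as combine a b : Fin (n G * n H),
-- decoded by remQuot (a bijection, Data.Fin.Properties)
_□_ : Graph → Graph → Graph
G □ H = record
  { n = n G * n H
  ; adj = λ x y → □adj G H (remQuot (n H) x) (remQuot (n H) y)
  ; adj-sym = λ x y → □adj-sym G H (remQuot (n H) x) (remQuot (n H) y)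
  ; adj-irrefl = λ x → □adj-irrefl G H (remQuot (n H) x)
  }

_⊔_ : Graph → Graph → Graph
G ⊔ H = record { n = n G + n H ; adj = A ; adj-sym = S ; adj-irrefl = I }
  where
  A : Fin (n G + n H) → Fin (n G + n H) → Bool
  A x y with splitAt (n G) x | splitAt (n G) y
  ... | inj₁ a | inj₁ a' = adj G a a'
  ... | inj₂ b | inj₂ b' = adj H b b'
  ... | inj₁ _ | inj₂ _  = false
  ... | inj₂ _ | inj₁ _  = false
  S : ∀ x y → A x y ≡ A y x
  S x y with splitAt (n G) x | splitAt (n G) y
  ... | inj₁ a | inj₁ a' = adj-sym G a a'
  ... | inj₂ b | inj₂ b' = adj-sym H b b'
  ... | inj₁ _ | inj₂ _  = refl
  ... | inj₂ _ | inj₁ _  = refl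
  I : ∀ x → A x x ≡ false
  I x with splitAt (n G) x
  ... | inj₁ a = adj-irrefl G a
  ... | inj₂ b = adj-irrefl H b

-- G₀ □ (G₁ □ (⋯ □ G_m))  and  H₀ ⊔ (H₁ ⊔ (⋯ ⊔ H_m)),  q = m + 1 factors
□-all : ∀ m → (Fin (suc m) → Graph) → Graph
□-all zero    G = G Fin.zero
□-all (suc m) G = G Fin.zero □ □-all m (λ i → G (Fin.suc i))

⊔-all : ∀ m → (Fin (suc m) → Graph) → Graph
⊔-all zero    H = H Fin.zero
⊔-all (suc m) H = H Fin.zero ⊔ ⊔-all m (λ i → H (Fin.suc i))

{-# OPTIONS --safe #-}
-- In G □ H the open neighbourhood of (a , b) is the cross N(a) × {b} ∪ {a} × N(b), the closed one is the
-- cross N[a] × {b} ∪ {a} × N[b], and every edge of G □ H inside such a cross lies within its row or within its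
-- column. Hence degrees, colour degrees and the numbers of (colour-j) edges inside open or closed
-- neighbourhoods add up, common neighbourhoods of adjacent vertices are those of the factor containing the
-- edge, and the link of (a , b) is the disjoint union of the links of a and of b. Taking the product of the
-- given graphs proves (i)-(iii); (iv) follows by induction on the number of factors.
module Submission where

open import Defs
open import Data.Nat using (ℕ; zero; suc; _+_; _*_; _≤_; _<_)
open import Data.Nat.Properties
  using (+-0-commutativeMonoid; +-identityʳ; +-comm; +-assoc; +-mono-<; *-mono-≤; *-distribˡ-+; *-cancelˡ-≡;
         ≤-trans; m≤m+n)
open import Data.Fin as Fin using (Fin; zero; suc; remQuot; combine; splitAt; _↑ˡ_; _↑ʳ_)
open import Data.Fin.Properties using (<-asym; <-cmp; remQuot-combine; combine-remQuot; *↔×; +↔⊎)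
open import Data.Bool using (Bool; true; false; _∧_; _∨_; if_then_else_; T)
open import Data.Bool.Properties
  using (∧-zeroʳ; ∨-identityʳ; ∨-comm; ∨-idem; ∧-assoc; ∧-comm; ∧-distribʳ-∨; T-irrelevant; T-∧; T-∨)
open import Data.Product using (Σ; ∃; _×_; _,_; proj₁; proj₂; swap; uncurry)
open import Data.Sum using (_⊎_; inj₁; inj₂)
open import Data.Sum.Function.Propositional using (_⊎-↔_)
open import Data.Empty using (⊥; ⊥-elim)
open import Function using (_∘_)
open import Function.Bundles using (_↔_; Inverse; mk↔ₛ′; Equivalence)
open import Function.Properties.Inverse using (↔-trans)
open import Relation.Binary using (tri<; tri≈; tri>)
open import Relation.Binary.PropositionalEquality
open import Relation.Nullary using (Dec; yes; no)
open import Relation.Nullary.Decidable using (⌊_⌋)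
import Algebra.Properties.CommutativeMonoid.Sum as CommutativeMonoidSum

open CommutativeMonoidSum +-0-commutativeMonoid using (sum; ∑-distrib-+; ∑-comm)
open ≡-Reasoning

Predᵇ Relᵇ : ℕ → Set
Predᵇ m = Fin m → Bool
Relᵇ m = Fin m → Fin m → Bool

Symmetricᵇ : ∀ {A : Set} → (A → A → Bool) → Set
Symmetricᵇ R = ∀ x y → R x y ≡ R y x

Irreflexiveᵇ : ∀ {A : Set} → (A → A → Bool) → Set
Irreflexiveᵇ R = ∀ x → R x x ≡ false

𝟙 : Bool → ℕ
𝟙 b = if b then 1 else 0

𝟙-∧ : ∀ c b → 𝟙 (c ∧ b) ≡ (if c then 𝟙 b else 0)
𝟙-∧ true  b = refl
𝟙-∧ false b = refl

𝟙-∧∧ : ∀ c d e → 𝟙 (c ∧ d ∧ e) ≡ (if c then (if d then 𝟙 e else 0) else 0)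
𝟙-∧∧ true  true  e = refl
𝟙-∧∧ true  false e = refl
𝟙-∧∧ false d     e = refl

𝟙-∨-disjoint : ∀ s t → (T s → T t → ⊥) → 𝟙 (s ∨ t) ≡ 𝟙 s + 𝟙 t
𝟙-∨-disjoint true  true  s∩t = ⊥-elim (s∩t _ _)
𝟙-∨-disjoint true  false s∩t = refl
𝟙-∨-disjoint false t     s∩t = refl

eqF-refl : ∀ {m} (a : Fin m) → eqF a a ≡ true
eqF-refl a with a Fin.≟ a
... | yes _  = refl
... | no a≢a = ⊥-elim (a≢a refl)

eqF-≢ : ∀ {m} {a b : Fin m} → a ≢ b → eqF a b ≡ false
eqF-≢ {a = a} {b} a≢b with a Fin.≟ b
... | yes a≡b = ⊥-elim (a≢b a≡b)
... | no _    = refl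

eqF-sym : ∀ {m} (a b : Fin m) → eqF a b ≡ eqF b a
eqF-sym a b with a Fin.≟ b
... | yes refl = sym (eqF-refl a)
... | no a≢b   = sym (eqF-≢ (a≢b ∘ sym))

eqF⇒≡ : ∀ {m} {a b : Fin m} → T (eqF a b) → a ≡ b
eqF⇒≡ {a = a} {b} t with a Fin.≟ b
... | yes a≡b = a≡b

eqF-suc : ∀ {m} (a b : Fin m) → eqF (suc a) (suc b) ≡ eqF a b
eqF-suc a b with a Fin.≟ b
... | yes refl = refl
... | no _     = refl

sumF≡sum : ∀ {m} (f : Fin m → ℕ) → sumF f ≡ sum f
sumF≡sum {zero}  f = refl
sumF≡sum {suc m} f = cong (f zero +_) (sumF≡sum (f ∘ suc))

sumF-cong : ∀ {m} {f g : Fin m → ℕ} → (∀ i → f i ≡ g i) → sumF f ≡ sumF g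
sumF-cong {zero}  f≗g = refl
sumF-cong {suc m} f≗g = cong₂ _+_ (f≗g zero) (sumF-cong (f≗g ∘ suc))

sumF-+ : ∀ {m} (f g : Fin m → ℕ) → sumF (λ i → f i + g i) ≡ sumF f + sumF g
sumF-+ f g = begin
  sumF (λ i → f i + g i)  ≡⟨ sumF≡sum (λ i → f i + g i) ⟩
  sum (λ i → f i + g i)   ≡⟨ ∑-distrib-+ f g ⟩
  sum f + sum g           ≡⟨ cong₂ _+_ (sumF≡sum f) (sumF≡sum g) ⟨
  sumF f + sumF g         ∎

sumF-comm : ∀ {m n} (f : Fin m → Fin n → ℕ) → sumF (λ i → sumF (f i)) ≡ sumF (λ j → sumF (λ i → f i j))
sumF-comm f = begin
  sumF (λ i → sumF (f i))           ≡⟨ sumF-cong (λ i → sumF≡sum (f i)) ⟩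
  sumF (λ i → sum (f i))            ≡⟨ sumF≡sum (λ i → sum (f i)) ⟩
  sum (λ i → sum (f i))             ≡⟨ ∑-comm f ⟩
  sum (λ j → sum (λ i → f i j))     ≡⟨ sumF≡sum (λ j → sum (λ i → f i j)) ⟨
  sumF (λ j → sum (λ i → f i j))    ≡⟨ sumF-cong (λ j → sumF≡sum (λ i → f i j)) ⟨
  sumF (λ j → sumF (λ i → f i j))   ∎

sumF-if : ∀ {m} c (f : Fin m → ℕ) → sumF (λ i → if c then f i else 0) ≡ (if c then sumF f else 0)
sumF-if     true  f = refl
sumF-if {m} false f = sumF-zero {m}
  where
  sumF-zero : ∀ {m} → sumF {m} (λ _ → 0) ≡ 0
  sumF-zero {zero}  = refl
  sumF-zero {suc m} = sumF-zero {m}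

sumF-δ : ∀ {m} (a : Fin m) (f : Fin m → ℕ) → sumF (λ i → if eqF a i then f i else 0) ≡ f a
sumF-δ {suc m} zero    f = trans (cong (f zero +_) (sumF-if false (f ∘ suc))) (+-identityʳ (f zero))
sumF-δ {suc m} (suc a) f =
  trans (sumF-cong λ i → cong (λ c → if c then f (suc i) else 0) (eqF-suc a i)) (sumF-δ a (f ∘ suc))

sumF-↑ : ∀ m n (h : Fin (m + n) → ℕ) → sumF h ≡ sumF (h ∘ (_↑ˡ n)) + sumF (h ∘ (m ↑ʳ_))
sumF-↑ zero    n h = refl
sumF-↑ (suc m) n h = trans (cong (h zero +_) (sumF-↑ m n (h ∘ suc))) (sym (+-assoc (h zero) _ _))

sumF-combine : ∀ m n (h : Fin (m * n) → ℕ) →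
               sumF h ≡ sumF (λ (a : Fin m) → sumF (λ (b : Fin n) → h (combine a b)))
sumF-combine zero    n h = refl
sumF-combine (suc m) n h =
  trans (sumF-↑ n (m * n) h) (cong (sumF (h ∘ (_↑ˡ m * n)) +_) (sumF-combine m n (h ∘ (n ↑ʳ_))))

sumPairs : ∀ {m n} → (Fin m × Fin n → ℕ) → ℕ
sumPairs g = sumF λ x → sumF λ y → g (x , y)

sumF-remQuot : ∀ m n (g : Fin m × Fin n → ℕ) → sumF (g ∘ remQuot {m} n) ≡ sumPairs g
sumF-remQuot m n g =
  trans (sumF-combine m n (g ∘ remQuot {m} n)) (sumF-cong λ a → sumF-cong λ b → cong g (remQuot-combine a b))

sumPairs-cong : ∀ {m n} {f g : Fin m × Fin n → ℕ} → (∀ p → f p ≡ g p) → sumPairs f ≡ sumPairs g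
sumPairs-cong f≗g = sumF-cong λ x → sumF-cong λ y → f≗g (x , y)

sumPairs-+ : ∀ {m n} (f g : Fin m × Fin n → ℕ) →
             sumPairs (λ p → f p + g p) ≡ sumPairs f + sumPairs g
sumPairs-+ f g = trans (sumF-cong λ x → sumF-+ (λ y → f (x , y)) (λ y → g (x , y)))
                       (sumF-+ (λ x → sumF λ y → f (x , y)) (λ x → sumF λ y → g (x , y)))

sumPairs-swap : ∀ {m n} (g : Fin m × Fin n → ℕ) → sumPairs g ≡ sumPairs (g ∘ swap)
sumPairs-swap g = sumF-comm λ x y → g (x , y)

sumPairs-if : ∀ {m n} c (g : Fin m × Fin n → ℕ) →
              sumPairs (λ p → if c then g p else 0) ≡ (if c then sumPairs g else 0)
sumPairs-if c g =
  trans (sumF-cong λ x → sumF-if c (λ y → g (x , y))) (sumF-if c λ x → sumF λ y → g (x , y))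

sumPairs-column : ∀ {m n} (a : Fin m) (f : Fin m × Fin n → ℕ) →
                  sumPairs (λ p → if eqF a (proj₁ p) then f p else 0) ≡ sumF (λ y → f (a , y))
sumPairs-column a f =
  trans (sumF-cong λ x → sumF-if (eqF a x) (λ y → f (x , y))) (sumF-δ a λ x → sumF λ y → f (x , y))

sumPairs-row : ∀ {m n} (b : Fin n) (f : Fin m × Fin n → ℕ) →
               sumPairs (λ p → if eqF b (proj₂ p) then f p else 0) ≡ sumF (λ x → f (x , b))
sumPairs-row b f =
  trans (sumPairs-swap (λ p → if eqF b (proj₂ p) then f p else 0)) (sumPairs-column b (f ∘ swap))

sumPairs²-column : ∀ {m n} (a : Fin m) (Z : Fin n → Fin n → ℕ) →
                   sumPairs (λ p → sumPairs (λ q →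
                     if eqF a (proj₁ p) then (if eqF a (proj₁ q) then Z (proj₂ p) (proj₂ q) else 0) else 0))
                   ≡ sumF (λ y → sumF (Z y))
sumPairs²-column {m} {n} a Z =
  trans (sumPairs-cong {m} {n} λ p → sumPairs-if (eqF a (proj₁ p)) (inner p))
        (trans (sumPairs-column a (sumPairs ∘ inner)) (sumF-cong λ y → sumPairs-column a (Z y ∘ proj₂)))
  where
  inner : Fin m × Fin n → Fin m × Fin n → ℕ
  inner p q = if eqF a (proj₁ q) then Z (proj₂ p) (proj₂ q) else 0

sumPairs²-row : ∀ {m n} (b : Fin n) (Z : Fin m → Fin m → ℕ) →
                sumPairs (λ p → sumPairs (λ q →
                  if eqF b (proj₂ p) then (if eqF b (proj₂ q) then Z (proj₁ p) (proj₁ q) else 0) else 0))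
                ≡ sumF (λ x → sumF (Z x))
sumPairs²-row {m} {n} b Z =
  trans (sumPairs-cong {m} {n} λ p → sumPairs-if (eqF b (proj₂ p)) (inner p))
        (trans (sumPairs-row b (sumPairs ∘ inner)) (sumF-cong λ x → sumPairs-row b (Z x ∘ proj₁)))
  where
  inner : Fin m × Fin n → Fin m × Fin n → ℕ
  inner p q = if eqF b (proj₂ q) then Z (proj₁ p) (proj₁ q) else 0

𝟙-split-< : ∀ {m} (p : Relᵇ m) → Symmetricᵇ p → Irreflexiveᵇ p → ∀ x y →
            𝟙 (p x y) ≡ 𝟙 (⌊ x Fin.<? y ⌋ ∧ p x y) + 𝟙 (⌊ y Fin.<? x ⌋ ∧ p y x)
𝟙-split-< p p-sym p-irr x y with x Fin.<? y | y Fin.<? x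
... | yes x<y | yes y<x = ⊥-elim (<-asym x<y y<x)
... | yes _   | no _    = sym (+-identityʳ _)
... | no _    | yes _   = cong 𝟙 (p-sym x y)
... | no x≮y  | no y≮x  with <-cmp x y
...   | tri< x<y _ _    = ⊥-elim (x≮y x<y)
...   | tri≈ _ refl _   = cong 𝟙 (p-irr x)
...   | tri> _ _ y<x    = ⊥-elim (y≮x y<x)

countPairs-double : ∀ {m} (p : Relᵇ m) → Symmetricᵇ p → Irreflexiveᵇ p →
                    2 * countPairs p ≡ sumF (λ x → count (p x))
countPairs-double p p-sym p-irr = begin
  2 * countPairs p                                     ≡⟨ cong (countPairs p +_) (+-identityʳ _) ⟩
  countPairs p + countPairs p                          ≡⟨ cong (countPairs p +_) (sumF-comm upward) ⟩
  countPairs p + sumF (λ x → sumF (λ y → upward y x))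
    ≡⟨ sumF-+ (sumF ∘ upward) (λ x → sumF (λ y → upward y x)) ⟨
  sumF (λ x → sumF (upward x) + sumF (λ y → upward y x))
    ≡⟨ sumF-cong (λ x → sumF-+ (upward x) (λ y → upward y x)) ⟨
  sumF (λ x → sumF (λ y → upward x y + upward y x))
    ≡⟨ sumF-cong (λ x → sumF-cong (𝟙-split-< p p-sym p-irr x)) ⟨
  sumF (λ x → count (p x))                             ∎
  where
  upward : Fin _ → Fin _ → ℕ
  upward x y = 𝟙 (⌊ x Fin.<? y ⌋ ∧ p x y)

pairsIn : ∀ {m} → Relᵇ m → Predᵇ m → ℕ
pairsIn R S = countPairs (λ x y → S x ∧ S y ∧ R x y)

pairsIn-cong : ∀ {m} {R R′ : Relᵇ m} {S S′ : Predᵇ m} →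
               (∀ x y → S x ∧ S y ∧ R x y ≡ S′ x ∧ S′ y ∧ R′ x y) → pairsIn R S ≡ pairsIn R′ S′
pairsIn-cong eq = sumF-cong λ x → sumF-cong λ y → cong (λ b → 𝟙 (⌊ x Fin.<? y ⌋ ∧ b)) (eq x y)

orderedPairsIn : ∀ {m} → Relᵇ m → Predᵇ m → ℕ
orderedPairsIn R S = sumF λ x → sumF λ y → 𝟙 (R x y ∧ S x ∧ S y)

pairsIn-double : ∀ {m} {R : Relᵇ m} → Symmetricᵇ R → Irreflexiveᵇ R → (S : Predᵇ m) →
                 2 * pairsIn R S ≡ orderedPairsIn R S
pairsIn-double {R = R} R-sym R-irr S =
  trans (countPairs-double (λ x y → S x ∧ S y ∧ R x y) restricted-sym restricted-irr)
        (sumF-cong λ x → sumF-cong λ y → cong 𝟙 (rotate (S x) (S y) (R x y)))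
  where
  rotate : ∀ s t r → s ∧ t ∧ r ≡ r ∧ s ∧ t
  rotate s t r = trans (sym (∧-assoc s t r)) (∧-comm (s ∧ t) r)
  restricted-sym : ∀ x y → S x ∧ S y ∧ R x y ≡ S y ∧ S x ∧ R y x
  restricted-sym x y rewrite R-sym x y with S x | S y
  ... | true  | _     = refl
  ... | false | true  = refl
  ... | false | false = refl
  restricted-irr : ∀ x → S x ∧ S x ∧ R x x ≡ false
  restricted-irr x rewrite R-irr x | ∧-zeroʳ (S x) = ∧-zeroʳ (S x)

-- ({a} × B) ∪ (A × {b}): the shape of every open or closed neighbourhood of (a , b) in a Cartesian product
cross : ∀ {m n} → Fin m × Fin n → Predᵇ m → Predᵇ n → Fin m × Fin n → Bool
cross (a , b) A B (x , y) = (eqF a x ∧ B y) ∨ (eqF b y ∧ A x)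

cartesian : ∀ {m n} → Relᵇ m → Relᵇ n → Fin m × Fin n → Fin m × Fin n → Bool
cartesian R S p q = cross p (R (proj₁ p)) (S (proj₂ p)) q

module _ {m n} {A : Predᵇ m} {B : Predᵇ n} where

  cross-swap : ∀ a b x y → cross (a , b) A B (x , y) ≡ cross (b , a) B A (y , x)
  cross-swap a b x y = ∨-comm (eqF a x ∧ B y) (eqF b y ∧ A x)

  centre-absorbed : ∀ {a b} → A a ≡ B b → ∀ y → B y ∨ (eqF b y ∧ A a) ≡ B y
  centre-absorbed {a} {b} Aa≡Bb y with b Fin.≟ y
  ... | yes refl rewrite Aa≡Bb = ∨-idem (B b)
  ... | no _     = ∨-identityʳ (B y)

  cross-column : ∀ {a b} → A a ≡ B b → ∀ y → cross (a , b) A B (a , y) ≡ B y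
  cross-column {a} Aa≡Bb y rewrite eqF-refl a = centre-absorbed Aa≡Bb y

  cross-off-column : ∀ {a b x} → a ≢ x → ∀ y → cross (a , b) A B (x , y) ≡ eqF b y ∧ A x
  cross-off-column a≢x y rewrite eqF-≢ a≢x = refl

  𝟙-cross : ∀ {a b} → A a ≡ false → ∀ x y →
            𝟙 (cross (a , b) A B (x , y)) ≡ (if eqF a x then 𝟙 (B y) else 0) + (if eqF b y then 𝟙 (A x) else 0)
  𝟙-cross {a} {b} Aa≡false x y =
    trans (𝟙-∨-disjoint _ _ disjoint) (cong₂ _+_ (𝟙-∧ (eqF a x) (B y)) (𝟙-∧ (eqF b y) (A x)))
    where
    disjoint : T (eqF a x ∧ B y) → T (eqF b y ∧ A x) → ⊥
    disjoint t u with eqF⇒≡ {a = a} {x} (proj₁ (Equivalence.to T-∧ t))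
    ... | refl = subst T Aa≡false (proj₂ (Equivalence.to T-∧ u))

cross-row : ∀ {m n} {A : Predᵇ m} {B : Predᵇ n} {a b} → A a ≡ B b → ∀ x → cross (a , b) A B (x , b) ≡ A x
cross-row {A = A} {B} {a} {b} Aa≡Bb x =
  trans (cross-swap {A = A} {B} a b x b) (cross-column {A = B} {A} (sym Aa≡Bb) x)

count-cross : ∀ {m n} {A : Predᵇ m} {B : Predᵇ n} {a b} → A a ≡ false →
              sumPairs (𝟙 ∘ cross (a , b) A B) ≡ count A + count B
count-cross {m} {n} {A} {B} {a} {b} Aa≡false = begin
  sumPairs (𝟙 ∘ cross (a , b) A B)   ≡⟨ sumPairs-cong {m} {n} (λ (x , y) → 𝟙-cross {A = A} {B} Aa≡false x y) ⟩
  sumPairs (λ p → column p + row p)  ≡⟨ sumPairs-+ column row ⟩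
  sumPairs column + sumPairs row     ≡⟨ cong₂ _+_ (sumPairs-column a (𝟙 ∘ B ∘ proj₂))
                                                   (sumPairs-row b (𝟙 ∘ A ∘ proj₁)) ⟩
  count B + count A                  ≡⟨ +-comm (count B) (count A) ⟩
  count A + count B                  ∎
  where
  column row : Fin m × Fin n → ℕ
  column (x , y) = if eqF a x then 𝟙 (B y) else 0
  row    (x , y) = if eqF b y then 𝟙 (A x) else 0

cross-∧-column : ∀ {m n} {A A′ : Predᵇ m} {B B′ : Predᵇ n} {a b b′} →
                 A a ≡ false → A′ a ≡ false → b ≢ b′ → ∀ x y →
                 cross (a , b) A B (x , y) ∧ cross (a , b′) A′ B′ (x , y) ≡ eqF a x ∧ (B y ∧ B′ y)
cross-∧-column {A = A} {A′} {B} {B′} {a} {b} {b′} Aa≡false A′a≡false b≢b′ x y with a Fin.≟ x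
... | yes refl rewrite Aa≡false | A′a≡false | ∧-zeroʳ (eqF b y) | ∧-zeroʳ (eqF b′ y)
                     | ∨-identityʳ (B y) | ∨-identityʳ (B′ y) = refl
... | no _ with b Fin.≟ y
...   | no _     = refl
...   | yes refl rewrite eqF-≢ (b≢b′ ∘ sym) = ∧-zeroʳ (A x)

count-cross-∧-column : ∀ {m n} {A A′ : Predᵇ m} {B B′ : Predᵇ n} {a b b′} →
                       A a ≡ false → A′ a ≡ false → b ≢ b′ →
                       sumPairs (λ p → 𝟙 (cross (a , b) A B p ∧ cross (a , b′) A′ B′ p))
                       ≡ count (λ y → B y ∧ B′ y)
count-cross-∧-column {m} {n} {A} {A′} {B} {B′} {a} Aa≡false A′a≡false b≢b′ =
  trans (sumPairs-cong {m} {n} λ (x , y) →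
           trans (cong 𝟙 (cross-∧-column {A = A} {A′} {B} {B′} Aa≡false A′a≡false b≢b′ x y))
                 (𝟙-∧ (eqF a x) _))
        (sumPairs-column a λ (_ , y) → 𝟙 (B y ∧ B′ y))

count-cross-∧-row : ∀ {m n} {A A′ : Predᵇ m} {B B′ : Predᵇ n} {a a′ b} →
                    B b ≡ false → B′ b ≡ false → a ≢ a′ →
                    sumPairs (λ p → 𝟙 (cross (a , b) A B p ∧ cross (a′ , b) A′ B′ p))
                    ≡ count (λ x → A x ∧ A′ x)
count-cross-∧-row {m} {n} {A} {A′} {B} {B′} {a} {a′} {b} Bb≡false B′b≡false a≢a′ = begin
  sumPairs (λ p → 𝟙 (cross (a , b) A B p ∧ cross (a′ , b) A′ B′ p))
    ≡⟨ sumPairs-swap (λ p → 𝟙 (cross (a , b) A B p ∧ cross (a′ , b) A′ B′ p)) ⟩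
  sumPairs (λ (y , x) → 𝟙 (cross (a , b) A B (x , y) ∧ cross (a′ , b) A′ B′ (x , y)))
    ≡⟨ sumPairs-cong {n} {m} (λ (y , x) → cong₂ (λ s t → 𝟙 (s ∧ t)) (cross-swap {A = A} {B} a b x y)
                                                                   (cross-swap {A = A′} {B′} a′ b x y)) ⟩
  sumPairs (λ p → 𝟙 (cross (b , a) B A p ∧ cross (b , a′) B′ A′ p))
    ≡⟨ count-cross-∧-column {A = B} {B′} {A} {A′} Bb≡false B′b≡false a≢a′ ⟩
  count (λ x → A x ∧ A′ x) ∎

cross-column-pair : ∀ {m n} {A : Predᵇ m} {B : Predᵇ n} {S : Relᵇ n} {a b} →
                    A a ≡ B b → Irreflexiveᵇ S → ∀ x y x′ y′ →
                    (eqF x x′ ∧ S y y′) ∧ cross (a , b) A B (x , y) ∧ cross (a , b) A B (x′ , y′)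
                    ≡ eqF a x ∧ eqF a x′ ∧ S y y′ ∧ B y ∧ B y′
cross-column-pair {A = A} {B} {S} {a} {b} Aa≡Bb S-irr x y x′ y′ with a Fin.≟ x
... | yes refl with a Fin.≟ x′
...   | yes refl = cong₂ (λ s t → S y y′ ∧ s ∧ t) (centre-absorbed {A = A} {B} Aa≡Bb y)
                                                   (centre-absorbed {A = A} {B} Aa≡Bb y′)
...   | no _     = refl
cross-column-pair {A = A} {B} {S} {a} {b} Aa≡Bb S-irr x y x′ y′ | no a≢x with x Fin.≟ x′
...   | no _     = refl
...   | yes refl with b Fin.≟ y | b Fin.≟ y′
...     | no _     | _        = ∧-zeroʳ (S y y′)
...     | yes refl | no _     rewrite eqF-≢ a≢x = trans (cong (S b y′ ∧_) (∧-zeroʳ (A x))) (∧-zeroʳ (S b y′))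
...     | yes refl | yes refl rewrite S-irr b = refl

cross-row-pair : ∀ {m n} {A : Predᵇ m} {B : Predᵇ n} {R : Relᵇ m} {a b} →
                 A a ≡ B b → Irreflexiveᵇ R → ∀ x y x′ y′ →
                 (eqF y y′ ∧ R x x′) ∧ cross (a , b) A B (x , y) ∧ cross (a , b) A B (x′ , y′)
                 ≡ eqF b y ∧ eqF b y′ ∧ R x x′ ∧ A x ∧ A x′
cross-row-pair {A = A} {B} {R} {a} {b} Aa≡Bb R-irr x y x′ y′ =
  trans (cong₂ (λ s t → (eqF y y′ ∧ R x x′) ∧ s ∧ t) (cross-swap {A = A} {B} a b x y)
                                                      (cross-swap {A = A} {B} a b x′ y′))
        (cross-column-pair {A = B} {A} {R} {b} {a} (sym Aa≡Bb) R-irr y x y′ x′)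

𝟙-cartesian-cross : ∀ {m n} {A : Predᵇ m} {B : Predᵇ n} {R : Relᵇ m} {S : Relᵇ n} {a b} →
                    A a ≡ B b → Irreflexiveᵇ R → Irreflexiveᵇ S → ∀ x y x′ y′ →
                    𝟙 (cartesian R S (x , y) (x′ , y′) ∧ cross (a , b) A B (x , y) ∧ cross (a , b) A B (x′ , y′))
                    ≡ (if eqF a x then (if eqF a x′ then 𝟙 (S y y′ ∧ B y ∧ B y′) else 0) else 0)
                      + (if eqF b y then (if eqF b y′ then 𝟙 (R x x′ ∧ A x ∧ A x′) else 0) else 0)
𝟙-cartesian-cross {A = A} {B} {R} {S} {a} {b} Aa≡Bb R-irr S-irr x y x′ y′ = begin
  𝟙 ((column ∨ row) ∧ inside)             ≡⟨ cong 𝟙 (∧-distribʳ-∨ inside column row) ⟩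
  𝟙 ((column ∧ inside) ∨ (row ∧ inside))  ≡⟨ 𝟙-∨-disjoint _ _ disjoint ⟩
  𝟙 (column ∧ inside) + 𝟙 (row ∧ inside)
    ≡⟨ cong₂ (λ s t → 𝟙 s + 𝟙 t) (cross-column-pair {A = A} {B} {S} Aa≡Bb S-irr x y x′ y′)
                                  (cross-row-pair {A = A} {B} {R} Aa≡Bb R-irr x y x′ y′) ⟩
  𝟙 (eqF a x ∧ eqF a x′ ∧ S y y′ ∧ B y ∧ B y′) + 𝟙 (eqF b y ∧ eqF b y′ ∧ R x x′ ∧ A x ∧ A x′)
    ≡⟨ cong₂ _+_ (𝟙-∧∧ (eqF a x) (eqF a x′) (S y y′ ∧ B y ∧ B y′))
                 (𝟙-∧∧ (eqF b y) (eqF b y′) (R x x′ ∧ A x ∧ A x′)) ⟩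
  _ ∎
  where
  column row inside : Bool
  column = eqF x x′ ∧ S y y′
  row    = eqF y y′ ∧ R x x′
  inside = cross (a , b) A B (x , y) ∧ cross (a , b) A B (x′ , y′)
  disjoint : T (column ∧ inside) → T (row ∧ inside) → ⊥
  disjoint t u with eqF⇒≡ {a = x} {x′} (proj₁ (Equivalence.to T-∧ (proj₁ (Equivalence.to (T-∧ {column}) t))))
  ... | refl = subst T (R-irr x) (proj₂ (Equivalence.to (T-∧ {eqF y y′}) (proj₁ (Equivalence.to (T-∧ {row}) u))))

orderedPairsIn-cartesian : ∀ {m n} {A : Predᵇ m} {B : Predᵇ n} {R : Relᵇ m} {S : Relᵇ n} {a b} →
                           A a ≡ B b → Irreflexiveᵇ R → Irreflexiveᵇ S →
                           sumPairs (λ p → sumPairs (λ q →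
                             𝟙 (cartesian R S p q ∧ cross (a , b) A B p ∧ cross (a , b) A B q)))
                           ≡ orderedPairsIn R A + orderedPairsIn S B
orderedPairsIn-cartesian {m} {n} {A} {B} {R} {S} {a} {b} Aa≡Bb R-irr S-irr = begin
  sumPairs (λ p → sumPairs (λ q → 𝟙 (cartesian R S p q ∧ cross (a , b) A B p ∧ cross (a , b) A B q)))
    ≡⟨ sumPairs-cong {m} {n} (λ (x , y) → sumPairs-cong {m} {n} λ (x′ , y′) →
         𝟙-cartesian-cross {A = A} {B} {R} {S} Aa≡Bb R-irr S-irr x y x′ y′) ⟩
  sumPairs (λ p → sumPairs (λ q → column p q + row p q))
    ≡⟨ sumPairs-cong {m} {n} (λ p → sumPairs-+ (column p) (row p)) ⟩
  sumPairs (λ p → sumPairs (column p) + sumPairs (row p))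
    ≡⟨ sumPairs-+ (sumPairs ∘ column) (sumPairs ∘ row) ⟩
  sumPairs (sumPairs ∘ column) + sumPairs (sumPairs ∘ row)
    ≡⟨ cong₂ _+_ (sumPairs²-column a λ y y′ → 𝟙 (S y y′ ∧ B y ∧ B y′))
                 (sumPairs²-row b λ x x′ → 𝟙 (R x x′ ∧ A x ∧ A x′)) ⟩
  orderedPairsIn S B + orderedPairsIn R A
    ≡⟨ +-comm (orderedPairsIn S B) (orderedPairsIn R A) ⟩
  orderedPairsIn R A + orderedPairsIn S B ∎
  where
  column row : Fin m × Fin n → Fin m × Fin n → ℕ
  column (x , y) (x′ , y′) = if eqF a x then (if eqF a x′ then 𝟙 (S y y′ ∧ B y ∧ B y′) else 0) else 0
  row    (x , y) (x′ , y′) = if eqF b y then (if eqF b y′ then 𝟙 (R x x′ ∧ A x ∧ A x′) else 0) else 0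

cartesian-sym : ∀ {m n} {R : Relᵇ m} {S : Relᵇ n} →
                Symmetricᵇ R → Symmetricᵇ S → Symmetricᵇ (cartesian R S)
cartesian-sym R-sym S-sym (x , y) (x′ , y′) =
  cong₂ _∨_ (cong₂ _∧_ (eqF-sym x x′) (S-sym y y′)) (cong₂ _∧_ (eqF-sym y y′) (R-sym x x′))

cartesian-irr : ∀ {m n} {R : Relᵇ m} {S : Relᵇ n} →
                Irreflexiveᵇ R → Irreflexiveᵇ S → Irreflexiveᵇ (cartesian R S)
cartesian-irr R-irr S-irr (x , y) rewrite R-irr x | S-irr y | ∧-zeroʳ (eqF x x) | ∧-zeroʳ (eqF y y) = refl

-- Pairs are counted as ordered pairs, since the condition x < y of countPairs does not respect the
-- decomposition of a cross into its row and its column.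
pairsIn-cartesian : ∀ {m n} {A : Predᵇ m} {B : Predᵇ n} {R : Relᵇ m} {S : Relᵇ n} {a b} →
                    Symmetricᵇ R → Irreflexiveᵇ R → Symmetricᵇ S → Irreflexiveᵇ S → A a ≡ B b →
                    pairsIn (λ u w → cartesian R S (remQuot {m} n u) (remQuot n w))
                            (λ u → cross (a , b) A B (remQuot {m} n u))
                    ≡ pairsIn R A + pairsIn S B
pairsIn-cartesian {m} {n} {A} {B} {R} {S} {a} {b} R-sym R-irr S-sym S-irr Aa≡Bb =
  *-cancelˡ-≡ _ _ 2 (begin
    2 * pairsIn R□ C□
      ≡⟨ pairsIn-double (λ u w → cartesian-sym {R = R} {S} R-sym S-sym (rq u) (rq w))
                        (λ u → cartesian-irr {R = R} {S} R-irr S-irr (rq u)) C□ ⟩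
    orderedPairsIn R□ C□
      ≡⟨ sumF-remQuot m n (λ p → sumF λ w → summand p (rq w)) ⟩
    sumPairs (λ p → sumF λ w → summand p (rq w))
      ≡⟨ sumPairs-cong {m} {n} (λ p → sumF-remQuot m n (summand p)) ⟩
    sumPairs (λ p → sumPairs (summand p))
      ≡⟨ orderedPairsIn-cartesian {A = A} {B} {R} {S} Aa≡Bb R-irr S-irr ⟩
    orderedPairsIn R A + orderedPairsIn S B
      ≡⟨ cong₂ _+_ (pairsIn-double R-sym R-irr A) (pairsIn-double S-sym S-irr B) ⟨
    2 * pairsIn R A + 2 * pairsIn S B
      ≡⟨ *-distribˡ-+ 2 (pairsIn R A) (pairsIn S B) ⟨
    2 * (pairsIn R A + pairsIn S B) ∎)
  where
  rq : Fin (m * n) → Fin m × Fin n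
  rq = remQuot {m} n
  R□ : Relᵇ (m * n)
  R□ u w = cartesian R S (rq u) (rq w)
  C□ : Predᵇ (m * n)
  C□ u = cross (a , b) A B (rq u)
  summand : Fin m × Fin n → Fin m × Fin n → ℕ
  summand p q = 𝟙 (cartesian R S p q ∧ cross (a , b) A B p ∧ cross (a , b) A B q)

-- The closed neighbourhood N[v], written exactly as inside IsFlipColouring, so that its numbers e v j of
-- colour-j edges are pairsIn (coloured (adj G) f j) (closedN G v) by definition.
closedN : (K : Graph) → Fin (n K) → Predᵇ (n K)
closedN K v x = eqF x v ∨ adj K v x

closedN-centre : ∀ (K : Graph) v → closedN K v v ≡ true
closedN-centre K v rewrite eqF-refl v = refl

cross-with-centre : ∀ {m n} (A : Predᵇ m) (B : Predᵇ n) a b x y →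
                    (eqF x a ∧ eqF y b) ∨ cross (a , b) A B (x , y)
                    ≡ cross (a , b) (λ x → eqF x a ∨ A x) (λ y → eqF y b ∨ B y) (x , y)
cross-with-centre A B a b x y rewrite eqF-sym x a | eqF-sym y b with a Fin.≟ x | b Fin.≟ y
... | yes _ | yes _ = refl
... | yes _ | no _  = refl
... | no _  | yes _ = refl
... | no _  | no _  = refl

eqF-remQuot : ∀ m n (u w : Fin (m * n)) →
              eqF u w ≡ eqF (proj₁ (remQuot {m} n u)) (proj₁ (remQuot {m} n w))
                        ∧ eqF (proj₂ (remQuot {m} n u)) (proj₂ (remQuot {m} n w))
eqF-remQuot m n u w with u Fin.≟ w
... | yes refl rewrite eqF-refl (proj₁ (remQuot {m} n u)) | eqF-refl (proj₂ (remQuot {m} n u)) = refl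
... | no u≢w with proj₁ (remQuot {m} n u) Fin.≟ proj₁ (remQuot {m} n w)
                | proj₂ (remQuot {m} n u) Fin.≟ proj₂ (remQuot {m} n w)
...   | no _     | _        = refl
...   | yes _    | no _     = refl
...   | yes x≡x′ | yes y≡y′ = ⊥-elim (u≢w (begin
  u                                  ≡⟨ combine-remQuot {m} n u ⟨
  uncurry combine (remQuot {m} n u)  ≡⟨ cong (uncurry combine) (cong₂ _,_ x≡x′ y≡y′) ⟩
  uncurry combine (remQuot {m} n w)  ≡⟨ combine-remQuot {m} n w ⟩
  w                                  ∎))

colouring-□ : ∀ {m n k} → (Fin m → Fin m → Fin k) → (Fin n → Fin n → Fin k) →
              Fin m × Fin n → Fin m × Fin n → Fin k
colouring-□ f g (x , y) (x′ , y′) = if eqF x x′ then g y y′ else f x x′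

colouring-□-sym : ∀ {m n k} {f : Fin m → Fin m → Fin k} {g : Fin n → Fin n → Fin k} →
                  (∀ x x′ → f x x′ ≡ f x′ x) → (∀ y y′ → g y y′ ≡ g y′ y) →
                  ∀ p q → colouring-□ f g p q ≡ colouring-□ f g q p
colouring-□-sym f-sym g-sym (x , y) (x′ , y′) rewrite eqF-sym x x′ with eqF x′ x
... | true  = g-sym y y′
... | false = f-sym x x′

coloured : ∀ {m k} → Relᵇ m → (Fin m → Fin m → Fin k) → Fin k → Relᵇ m
coloured R f j x y = R x y ∧ eqF (f x y) j

coloured-sym : ∀ {m k} {R : Relᵇ m} {f : Fin m → Fin m → Fin k} →
               Symmetricᵇ R → (∀ x y → f x y ≡ f y x) → ∀ j → Symmetricᵇ (coloured R f j)
coloured-sym R-sym f-sym j x y = cong₂ _∧_ (R-sym x y) (cong (λ c → eqF c j) (f-sym x y))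

coloured-irr : ∀ {m k} {R : Relᵇ m} {f : Fin m → Fin m → Fin k} →
               Irreflexiveᵇ R → ∀ j → Irreflexiveᵇ (coloured R f j)
coloured-irr {f = f} R-irr j x = cong (_∧ eqF (f x x) j) (R-irr x)

cartesian-coloured : ∀ {m n k} {R : Relᵇ m} {S : Relᵇ n} {f : Fin m → Fin m → Fin k} {g : Fin n → Fin n → Fin k} →
                     Irreflexiveᵇ R → ∀ j p q →
                     cartesian R S p q ∧ eqF (colouring-□ f g p q) j ≡ cartesian (coloured R f j) (coloured S g j) p q
cartesian-coloured {R = R} {S} {f} {g} R-irr j (x , y) (x′ , y′) with x Fin.≟ x′
... | yes refl rewrite R-irr x | ∧-zeroʳ (eqF y y′) | ∨-identityʳ (S y y′) =
  sym (∨-identityʳ (S y y′ ∧ eqF (g y y′) j))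
... | no _     = ∧-assoc (eqF y y′) (R x x′) (eqF (f x x′) j)

members-≡ : ∀ {A : Set} {P : A → Bool} {x y : A} {p : T (P x)} {q : T (P y)} →
            x ≡ y → _≡_ {A = Σ A (T ∘ P)} (x , p) (y , q)
members-≡ refl = cong (_ ,_) (T-irrelevant _ _)

restrict-↔ : ∀ {A B : Set} (e : A ↔ B) (P : B → Bool) → Σ B (T ∘ P) ↔ Σ A (T ∘ P ∘ Inverse.to e)
restrict-↔ e P = mk↔ₛ′
  (λ (y , t) → from y , subst (T ∘ P) (sym (strictlyInverseˡ y)) t)
  (λ (x , t) → to x , t)
  (λ (x , _) → members-≡ (strictlyInverseʳ x))
  (λ (y , _) → members-≡ (strictlyInverseˡ y))
  where open Inverse e

module _ {m n} {A : Predᵇ m} {B : Predᵇ n} {a b} (Aa≡false : A a ≡ false) (Bb≡false : B b ≡ false) where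

  private
    Aa≡Bb : A a ≡ B b
    Aa≡Bb = trans Aa≡false (sym Bb≡false)

    Parts Cross : Set
    Parts = Σ (Fin m) (T ∘ A) ⊎ Σ (Fin n) (T ∘ B)
    Cross = Σ (Fin m × Fin n) (T ∘ cross (a , b) A B)

    off-column : ∀ {x y} → a ≢ x → T (cross (a , b) A B (x , y)) → T (eqF b y) × T (A x)
    off-column {x} {y} a≢x t = Equivalence.to T-∧ (subst T (cross-off-column {A = A} {B} {a} {b} a≢x y) t)

    embed : Parts → Cross
    embed (inj₁ (x , t)) = (x , b) , subst T (sym (cross-row {A = A} {B} {a} {b} Aa≡Bb x)) t
    embed (inj₂ (y , t)) = (a , y) , subst T (sym (cross-column {A = A} {B} {a} {b} Aa≡Bb y)) t

    classify : ∀ x y → Dec (a ≡ x) → T (cross (a , b) A B (x , y)) → Parts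
    classify x y (yes refl) t = inj₂ (y , subst T (cross-column {A = A} {B} {a} {b} Aa≡Bb y) t)
    classify x y (no a≢x)   t = inj₁ (x , proj₂ (off-column a≢x t))

    embed-classify : ∀ x y a≟x t → embed (classify x y a≟x t) ≡ ((x , y) , t)
    embed-classify x y (yes refl) t = members-≡ refl
    embed-classify x y (no a≢x)   t = members-≡ (cong (x ,_) (eqF⇒≡ (proj₁ (off-column a≢x t))))

    classify-embed : ∀ s a≟x →
                     classify (proj₁ (proj₁ (embed s))) (proj₂ (proj₁ (embed s))) a≟x (proj₂ (embed s)) ≡ s
    classify-embed (inj₁ (x , t)) (yes refl) = ⊥-elim (subst T Aa≡false t)
    classify-embed (inj₁ (x , t)) (no _)     = cong inj₁ (members-≡ refl)
    classify-embed (inj₂ (y , t)) (yes refl) = cong inj₂ (members-≡ refl)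
    classify-embed (inj₂ (y , t)) (no a≢a)   = ⊥-elim (a≢a refl)

  ⊎↔cross : Parts ↔ Cross
  ⊎↔cross = mk↔ₛ′ embed (λ ((x , y) , t) → classify x y (a Fin.≟ x) t)
                  (λ ((x , y) , t) → embed-classify x y (a Fin.≟ x) t)
                  (λ s → classify-embed s (a Fin.≟ proj₁ (proj₁ (embed s))))

adj⇒≢ : ∀ (K : Graph) {u w} → T (adj K u w) → u ≢ w
adj⇒≢ K {u} t refl = subst T (adj-irrefl K u) t

NonEmpty-□ : ∀ G H → NonEmpty G → NonEmpty H → NonEmpty (G □ H)
NonEmpty-□ G H = *-mono-≤

module _ (G H : Graph) where

  private
    rq : Fin (n G * n H) → Fin (n G) × Fin (n H)
    rq = remQuot {n G} (n H)

  deg-□ : ∀ v → deg (G □ H) v ≡ deg G (proj₁ (rq v)) + deg H (proj₂ (rq v))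
  deg-□ v = trans (sumF-remQuot (n G) (n H) (𝟙 ∘ cartesian (adj G) (adj H) (rq v)))
                  (count-cross {A = adj G a} {adj H b} (adj-irrefl G a))
    where
    a = proj₁ (rq v)
    b = proj₂ (rq v)

  edgesIn-□ : ∀ v → edgesIn (G □ H) (adj (G □ H) v)
                    ≡ edgesIn G (adj G (proj₁ (rq v))) + edgesIn H (adj H (proj₂ (rq v)))
  edgesIn-□ v = pairsIn-cartesian {A = adj G a} {adj H b} {adj G} {adj H} {a} {b}
                  (adj-sym G) (adj-irrefl G) (adj-sym H) (adj-irrefl H) (trans (adj-irrefl G a) (sym (adj-irrefl H b)))
    where
    a = proj₁ (rq v)
    b = proj₂ (rq v)

  commonNeighbours-□ : ∀ {β} →
                       (∀ v u → T (adj G v u) → count (λ w → adj G v w ∧ adj G u w) ≡ β) →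
                       (∀ v u → T (adj H v u) → count (λ w → adj H v w ∧ adj H u w) ≡ β) →
                       ∀ v u → T (adj (G □ H) v u) → count (λ w → adj (G □ H) v w ∧ adj (G □ H) u w) ≡ β
  commonNeighbours-□ {β} G-common H-common v u v~u =
    trans (sumF-remQuot (n G) (n H) (λ r → 𝟙 (cartesian (adj G) (adj H) (rq v) r ∧ cartesian (adj G) (adj H) (rq u) r)))
          (common (rq v) (rq u) v~u)
    where
    common : ∀ p q → T (cartesian (adj G) (adj H) p q) →
             sumPairs (λ r → 𝟙 (cartesian (adj G) (adj H) p r ∧ cartesian (adj G) (adj H) q r)) ≡ β
    common (a , b) (a′ , b′) p~q with Equivalence.to (T-∨ {eqF a a′ ∧ adj H b b′}) p~q
    ... | inj₁ column-edge with eqF⇒≡ {a = a} {a′} (proj₁ (Equivalence.to T-∧ column-edge))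
    ...   | refl = trans (count-cross-∧-column {A = adj G a} {adj G a} {adj H b} {adj H b′}
                                                (adj-irrefl G a) (adj-irrefl G a) (adj⇒≢ H b~b′))
                         (H-common b b′ b~b′)
      where b~b′ = proj₂ (Equivalence.to (T-∧ {eqF a a}) column-edge)
    common (a , b) (a′ , b′) p~q | inj₂ row-edge with eqF⇒≡ {a = b} {b′} (proj₁ (Equivalence.to T-∧ row-edge))
    ...   | refl = trans (count-cross-∧-row {A = adj G a} {adj G a′} {adj H b} {adj H b}
                                             (adj-irrefl H b) (adj-irrefl H b) (adj⇒≢ G a~a′))
                         (G-common a a′ a~a′)
      where a~a′ = proj₂ (Equivalence.to (T-∧ {eqF b b}) row-edge)

  IsConstant-□ : ∀ {r c r′ c′} → IsConstant G r c → IsConstant H r′ c′ →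
                 IsConstant (G □ H) (r + r′) (c + c′)
  IsConstant-□ (G-regular , G-edges) (H-regular , H-edges) =
    (λ v → trans (deg-□ v) (cong₂ _+_ (G-regular _) (H-regular _))) ,
    (λ v → trans (edgesIn-□ v) (cong₂ _+_ (G-edges _) (H-edges _)))

  IsRBRegular-□ : ∀ {r r′ β} → IsRBRegular G r β → IsRBRegular H r′ β → IsRBRegular (G □ H) (r + r′) β
  IsRBRegular-□ (G-regular , G-common) (H-regular , H-common) =
    (λ v → trans (deg-□ v) (cong₂ _+_ (G-regular _) (H-regular _))) ,
    commonNeighbours-□ G-common H-common

  closedN-□ : ∀ v w →
              closedN (G □ H) v w ≡ cross (rq v) (closedN G (proj₁ (rq v))) (closedN H (proj₂ (rq v))) (rq w)
  closedN-□ v w = trans (cong (_∨ adj (G □ H) v w) (eqF-remQuot (n G) (n H) w v))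
                        (cross-with-centre (adj G a) (adj H b) a b (proj₁ (rq w)) (proj₂ (rq w)))
    where
    a = proj₁ (rq v)
    b = proj₂ (rq v)

  module _ {k} {f : Fin (n G) → Fin (n G) → Fin k} {g : Fin (n H) → Fin (n H) → Fin k} where

    private
      f□g : Fin (n G * n H) → Fin (n G * n H) → Fin k
      f□g u w = colouring-□ f g (rq u) (rq w)

    colourDeg-□ : ∀ j v → count (coloured (adj (G □ H)) f□g j v)
                          ≡ count (coloured (adj G) f j (proj₁ (rq v))) + count (coloured (adj H) g j (proj₂ (rq v)))
    colourDeg-□ j v =
      trans (sumF-remQuot (n G) (n H) λ q →
               𝟙 (cartesian (adj G) (adj H) (rq v) q ∧ eqF (colouring-□ f g (rq v) q) j))
      (trans (sumPairs-cong {n G} {n H} λ q →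
                cong 𝟙 (cartesian-coloured {R = adj G} {adj H} {f} {g} (adj-irrefl G) j (rq v) q))
             (count-cross {A = coloured (adj G) f j a} {coloured (adj H) g j b} {a} {b}
                          (coloured-irr {R = adj G} {f = f} (adj-irrefl G) j a)))
      where
      a = proj₁ (rq v)
      b = proj₂ (rq v)

    closedColouredEdges-□ : (∀ x x′ → f x x′ ≡ f x′ x) → (∀ y y′ → g y y′ ≡ g y′ y) →
                            ∀ j v → pairsIn (coloured (adj (G □ H)) f□g j) (closedN (G □ H) v)
                                    ≡ pairsIn (coloured (adj G) f j) (closedN G (proj₁ (rq v)))
                                      + pairsIn (coloured (adj H) g j) (closedN H (proj₂ (rq v)))
    closedColouredEdges-□ f-sym g-sym j v =
      trans (pairsIn-cong {R = coloured (adj (G □ H)) f□g j}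
                          {R′ = λ u w → cartesian (coloured (adj G) f j) (coloured (adj H) g j) (rq u) (rq w)}
                          {S = closedN (G □ H) v} {S′ = λ u → cross (a , b) (closedN G a) (closedN H b) (rq u)}
               λ x y → cong₂ _∧_ (closedN-□ v x) (cong₂ _∧_ (closedN-□ v y)
                         (cartesian-coloured {R = adj G} {adj H} {f} {g} (adj-irrefl G) j (rq x) (rq y))))
            (pairsIn-cartesian {A = closedN G a} {closedN H b} {coloured (adj G) f j} {coloured (adj H) g j}
              (coloured-sym {R = adj G} (adj-sym G) f-sym j) (coloured-irr {R = adj G} {f = f} (adj-irrefl G) j)
              (coloured-sym {R = adj H} (adj-sym H) g-sym j) (coloured-irr {R = adj H} {f = g} (adj-irrefl H) j)
              (trans (closedN-centre G a) (sym (closedN-centre H b))))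
      where
      a = proj₁ (rq v)
      b = proj₂ (rq v)

    IsFlipColouring-□ : ∀ {α β} → IsFlipColouring G k α f → IsFlipColouring H k β g →
                        IsFlipColouring (G □ H) k (λ j → α j + β j) f□g
    IsFlipColouring-□ (f-sym , f-deg , f-flip) (g-sym , g-deg , g-flip) =
      (λ u w → colouring-□-sym f-sym g-sym (rq u) (rq w)) ,
      (λ v j → trans (colourDeg-□ j v) (cong₂ _+_ (f-deg _ j) (g-deg _ j))) ,
      (λ v i j i<j → subst₂ _<_ (sym (closedColouredEdges-□ f-sym g-sym j v))
                                (sym (closedColouredEdges-□ f-sym g-sym i v))
                                (+-mono-< (f-flip _ i j i<j) (g-flip _ i j i<j)))

  adj-□-combine : ∀ p q → adj (G □ H) (uncurry combine p) (uncurry combine q) ≡ cartesian (adj G) (adj H) p q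
  adj-□-combine (x , y) (x′ , y′) = cong₂ (cartesian (adj G) (adj H)) (remQuot-combine x y) (remQuot-combine x′ y′)

  LinkIso-□ : ∀ {L₁ L₂} v → LinkIso G (proj₁ (rq v)) L₁ → LinkIso H (proj₂ (rq v)) L₂ →
              LinkIso (G □ H) v (L₁ ⊔ L₂)
  LinkIso-□ {L₁} {L₂} v (φ₁ , φ₁-adj) (φ₂ , φ₂-adj) = φ , φ-adj
    where
    a = proj₁ (rq v)
    b = proj₂ (rq v)
    φ : Fin (n L₁ + n L₂) ↔ Nbhd (G □ H) v
    φ = ↔-trans +↔⊎ (↔-trans (φ₁ ⊎-↔ φ₂)
          (↔-trans (⊎↔cross {A = adj G a} {adj H b} (adj-irrefl G a) (adj-irrefl H b))
                   (restrict-↔ *↔× (cross (a , b) (adj G a) (adj H b)))))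
    row-adj : ∀ x x′ → adj (G □ H) (combine x b) (combine x′ b) ≡ adj G x x′
    row-adj x x′ = trans (adj-□-combine (x , b) (x′ , b))
                         (cross-row {A = adj G x} {adj H b} (trans (adj-irrefl G x) (sym (adj-irrefl H b))) x′)
    column-adj : ∀ y y′ → adj (G □ H) (combine a y) (combine a y′) ≡ adj H y y′
    column-adj y y′ = trans (adj-□-combine (a , y) (a , y′))
                            (cross-column {A = adj G a} {adj H y} (trans (adj-irrefl G a) (sym (adj-irrefl H y))) y′)
    across-adj : ∀ {x y} → T (adj G a x) → T (adj H b y) → adj (G □ H) (combine x b) (combine a y) ≡ false
    across-adj {x} {y} a~x b~y
      rewrite adj-□-combine (x , b) (a , y) | eqF-≢ (adj⇒≢ G a~x ∘ sym) | eqF-≢ (adj⇒≢ H b~y) = refl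
    φ-adj : ∀ z₁ z₂ →
            adj (L₁ ⊔ L₂) z₁ z₂ ≡ adj (G □ H) (proj₁ (Inverse.to φ z₁)) (proj₁ (Inverse.to φ z₂))
    φ-adj z₁ z₂ with splitAt (n L₁) z₁ | splitAt (n L₁) z₂
    ... | inj₁ h₁ | inj₁ h₂ = trans (φ₁-adj h₁ h₂) (sym (row-adj _ _))
    ... | inj₂ h₁ | inj₂ h₂ = trans (φ₂-adj h₁ h₂) (sym (column-adj _ _))
    ... | inj₁ h₁ | inj₂ h₂ = sym (across-adj (proj₂ (Inverse.to φ₁ h₁)) (proj₂ (Inverse.to φ₂ h₂)))
    ... | inj₂ h₁ | inj₁ h₂ =
      sym (trans (adj-sym (G □ H) _ _) (across-adj (proj₂ (Inverse.to φ₁ h₂)) (proj₂ (Inverse.to φ₂ h₁))))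

IsFlipSequence-+ : ∀ {k α β} → IsFlipSequence k α → IsFlipSequence k β → IsFlipSequence k (λ i → α i + β i)
IsFlipSequence-+ (α-inc , α-pos , G , G-ne , f , f-flip) (β-inc , β-pos , H , H-ne , g , g-flip) =
  (λ i j i<j → +-mono-< (α-inc i j i<j) (β-inc i j i<j)) ,
  (λ i → ≤-trans (α-pos i) (m≤m+n _ _)) ,
  G □ H , NonEmpty-□ G H G-ne H-ne , _ , IsFlipColouring-□ G H f-flip g-flip

IsFlipSequence-resp : ∀ {k α β} → (∀ i → α i ≡ β i) → IsFlipSequence k α → IsFlipSequence k β
IsFlipSequence-resp α≗β (α-inc , α-pos , G , G-ne , f , f-sym , f-deg , f-flip) =
  (λ i j i<j → subst₂ _<_ (α≗β i) (α≗β j) (α-inc i j i<j)) ,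
  (λ i → subst (1 ≤_) (α≗β i) (α-pos i)) ,
  G , G-ne , f , f-sym , (λ v j → trans (f-deg v j) (α≗β j)) , f-flip

flipSequence-sum : ∀ {k} q (a : Fin (suc q) → Fin k → ℕ) → (∀ j → IsFlipSequence k (a j)) →
                   IsFlipSequence k (λ i → sumF (λ j → a j i))
flipSequence-sum zero    a a-flip = IsFlipSequence-resp (λ i → sym (+-identityʳ (a zero i))) (a-flip zero)
flipSequence-sum (suc q) a a-flip = IsFlipSequence-+ (a-flip zero) (flipSequence-sum q (a ∘ suc) (a-flip ∘ suc))

constantGraph-sum : ∀ q (r c : Fin (suc q) → ℕ) (H : Fin (suc q) → Graph) →
                    (∀ j → NonEmpty (H j) × IsConstant (H j) (r j) (c j)) →
                    ∃ λ G → NonEmpty G × IsConstant G (sumF r) (sumF c)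
constantGraph-sum zero r c H h =
  H zero , proj₁ (h zero) ,
  subst₂ (IsConstant (H zero)) (sym (+-identityʳ (r zero))) (sym (+-identityʳ (c zero))) (proj₂ (h zero))
constantGraph-sum (suc q) r c H h with constantGraph-sum q (r ∘ suc) (c ∘ suc) (H ∘ suc) (h ∘ suc)
... | G , G-ne , G-constant =
  H zero □ G , NonEmpty-□ (H zero) G (proj₁ (h zero)) G-ne , IsConstant-□ (H zero) G (proj₂ (h zero)) G-constant

rbRegularGraph-sum : ∀ q (r : Fin (suc q) → ℕ) β (H : Fin (suc q) → Graph) →
                     (∀ j → NonEmpty (H j) × IsRBRegular (H j) (r j) β) →
                     ∃ λ G → NonEmpty G × IsRBRegular G (sumF r) β
rbRegularGraph-sum zero r β H h =
  H zero , proj₁ (h zero) , subst (λ r₀ → IsRBRegular (H zero) r₀ β) (sym (+-identityʳ (r zero))) (proj₂ (h zero))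
rbRegularGraph-sum (suc q) r β H h with rbRegularGraph-sum q (r ∘ suc) β (H ∘ suc) (h ∘ suc)
... | G , G-ne , G-regular =
  H zero □ G , NonEmpty-□ (H zero) G (proj₁ (h zero)) G-ne , IsRBRegular-□ (H zero) G (proj₂ (h zero)) G-regular

IsConstantLink-□-all : ∀ m (G H : Fin (suc m) → Graph) → (∀ j → IsConstantLink (G j) (H j)) →
                       IsConstantLink (□-all m G) (⊔-all m H)
IsConstantLink-□-all zero    G H links = links zero
IsConstantLink-□-all (suc m) G H links v =
  LinkIso-□ (G zero) (□-all m (G ∘ suc)) v (links zero _)
            (IsConstantLink-□-all m (G ∘ suc) (H ∘ suc) (links ∘ suc) _)

lemma2p4 :
    (∀ (k q : ℕ) → 2 ≤ k → 1 ≤ q → (a : Fin q → Fin k → ℕ) →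
       (∀ j → IsFlipSequence k (a j)) →
       IsFlipSequence k (λ i → sumF (λ j → a j i)))
    ×
    (∀ (q : ℕ) → 1 ≤ q → (r c : Fin q → ℕ) → (H : Fin q → Graph) →
       (∀ j → NonEmpty (H j) × IsConstant (H j) (r j) (c j)) →
       ∃ λ G → NonEmpty G × IsConstant G (sumF r) (sumF c))
    ×
    (∀ (q : ℕ) → 1 ≤ q → (r : Fin q → ℕ) → (b : ℕ) → (H : Fin q → Graph) →
       (∀ j → NonEmpty (H j) × IsRBRegular (H j) (r j) b) →
       ∃ λ G → NonEmpty G × IsRBRegular G (sumF r) b)
    ×
    (∀ (m : ℕ) → (G H : Fin (suc m) → Graph) →
       (∀ j → NonEmpty (G j) × IsConstantLink (G j) (H j)) →
       IsConstantLink (□-all m G) (⊔-all m H))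
lemma2p4 =
  (λ { k (suc q) _ _ → flipSequence-sum q }) ,
  (λ { (suc q) _ → constantGraph-sum q }) ,
  (λ { (suc q) _ → rbRegularGraph-sum q }) ,
  (λ m G H h → IsConstantLink-□-all m G H (proj₂ ∘ h))
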